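{- Fix a positive integer $a$. For any positive integers $k,n$ with $k\geq n$, $$S_t(N_{k,n})=\sum_{i=1}^n\binom{k-i}{k-n}t^{n-i}N_{k,i}.$$
   Context: Let $\mathfrak{h}_t=\mathbb{Q}[t]\langle x,y\rangle$ ($t$ a variable) be the noncommutative polynomial algebra in letters $x,y$, and $z_k=x^{k-1}y$. $\sigma_t$ is the concatenation automorphism with $\sigma_t(x)=x$, $\sigma_t(y)=tx+y$; $S_t$ is the $\mathbb{Q}[t]$-linear map with $S_t(1)=1$, $S_t(wa)=\sigma_t(w)a$ for words $w$ and letters $a$. For $k\geq n\geq1$, $N_{k,n}=\sum_{k_1+\cdots+k_n=k,\ k_i\geq1}z_{ak_1}\cdots z_{ak_n}$. -}

module Defs where

open import Data.Nat as ℕ using (ℕ; zero; suc; _∸_; _≤_)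
import Data.Nat.Properties as ℕP
import Data.Integer as ℤ
open import Data.Nat.Combinatorics using (_C_)
open import Data.Rational as ℚ using (ℚ; 0ℚ; 1ℚ)
open import Data.List using (List; []; _∷_; _++_; map; concatMap; foldr; unsnoc; upTo; replicate)
open import Data.List.Properties using (≡-dec)
open import Data.Maybe using (Maybe; just; nothing)
open import Data.Product using (_×_; _,_)
open import Relation.Binary.PropositionalEquality using (_≡_; refl)
open import Relation.Nullary using (Dec; yes; no)
open import Relation.Nullary.Decidable using (_×-dec_)

data Letter : Set where
  x y : Letter

_≟L_ : (a b : Letter) → Dec (a ≡ b)
x ≟L x = yes refl
x ≟L y = no λ ()
y ≟L x = no λ ()
y ≟L y = yes refl

Word : Set
Word = List Letter

-- An element of h_t = ℚ[t]⟨x,y⟩ is represented as a finite formal sum of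
-- terms  c · t^j · w  (c ∈ ℚ, j ∈ ℕ, w a word); two representations denote
-- the same element iff all coefficients agree (see _≈_ below).
record Term : Set where
  constructor term
  field
    coef : ℚ
    tdeg : ℕ
    word : Word
open Term public

Poly : Set
Poly = List Term

coeff : Poly → ℕ → Word → ℚ
coeff [] j w = 0ℚ
coeff (term c d v ∷ p) j w with (d ℕ.≟ j) ×-dec (≡-dec _≟L_ v w)
... | yes _ = c ℚ.+ coeff p j w
... | no _  = coeff p j w

_≈_ : Poly → Poly → Set
p ≈ q = ∀ (j : ℕ) (w : Word) → coeff p j w ≡ coeff q j w

0P : Poly
0P = []

1P : Poly
1P = term 1ℚ 0 [] ∷ []

_+P_ : Poly → Poly → Poly
_+P_ = _++_

sumP : List Poly → Poly
sumP = foldr _+P_ 0P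

_*P_ : Poly → Poly → Poly
p *P q = concatMap (λ s → map (λ r → term (coef s ℚ.* coef r) (tdeg s ℕ.+ tdeg r) (word s ++ word r)) q) p

prodP : List Poly → Poly
prodP = foldr _*P_ 1P

scale : ℚ → ℕ → Poly → Poly
scale c j = map (λ r → term (c ℚ.* coef r) (j ℕ.+ tdeg r) (word r))

letter : Letter → Poly
letter a = term 1ℚ 0 (a ∷ []) ∷ []

σL : Letter → Poly
σL x = letter x
σL y = term 1ℚ 1 (x ∷ []) ∷ term 1ℚ 0 (y ∷ []) ∷ []

σW : Word → Poly
σW w = prodP (map σL w)

SW : Word → Poly
SW w with unsnoc w
... | nothing       = 1P
... | just (v , a)  = σW v *P letter a

S : Poly → Poly
S p = concatMap (λ r → scale (coef r) (tdeg r) (SW (word r))) p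

z : ℕ → Poly
z m = term 1ℚ 0 (replicate (m ∸ 1) x ++ y ∷ []) ∷ []

compositions : ℕ → ℕ → List (List ℕ)
compositions zero    zero    = [] ∷ []
compositions (suc k) zero    = []
compositions k       (suc n) =
  concatMap (λ i → map (suc i ∷_) (compositions (k ∸ suc i) n)) (upTo k)

N : ℕ → ℕ → ℕ → Poly
N a k n = sumP (map (λ ks → prodP (map (λ kᵢ → z (a ℕ.* kᵢ)) ks)) (compositions k n))

RHS : ℕ → ℕ → ℕ → Poly
RHS a k n = sumP (map (λ j → let i = suc j in
  scale ((ℤ.+ ((k ∸ i) C (k ∸ n)) ℚ./ 1)) (n ∸ i) (N a k i)) (upTo n))

{-# OPTIONS --safe #-}
module Submission where

-- Splitting off the first part of a composition gives N_{k+1,n+1} = z_a N_{k,n} + x^a N_{k,n+1}.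
-- For a nonempty word w we have S_t(uw) = σ_t(u) S_t(w), and σ_t(x^a) = x^a, σ_t(z_a) = t x^a + z_a,
-- so S_t(N_{k+1,n+1}) = (t x^a + z_a) S_t(N_{k,n}) + x^a S_t(N_{k,n+1}).  By Pascal's rule the
-- right-hand side obeys the same recursion, and for n = 1 both sides equal N_{k,1}, since S_t fixes
-- every z_m.  Polynomials are compared coefficientwise, so their term lists need only agree up to
-- reordering.

open import Defs
open import Algebra.Bundles using (CommutativeMonoid)
open import Algebra.Structures using (IsCommutativeMonoid)
open import Data.Empty using (⊥-elim)
open import Data.List using (List; []; _∷_; _++_; map; concatMap; applyUpTo; upTo; replicate; _∷ʳ_; InitLast; initLast; _∷ʳ′_; unsnoc)
open import Data.List.Relation.Unary.All using (All; []; _∷_)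
open import Data.Maybe using (just)
import Data.List.Effectful
import Data.List.Properties as List
open import Data.Nat as ℕ using (ℕ; zero; suc; _∸_; _≤_; _<_; z≤n; s≤s)
import Data.Nat.Properties as ℕ
open import Data.Product using (_×_; _,_; Σ)
import Data.Integer as ℤ
import Data.Integer.Properties as ℤ
open import Data.Nat.Combinatorics using (_C_; nCk+nC[k+1]≡[n+1]C[k+1]; nCk≡nC[n∸k])
import Data.Nat.Coprimality as Coprime
open import Data.Rational as ℚ using (ℚ; 0ℚ; 1ℚ)
import Data.Rational.Properties as ℚ
import Data.Rational.Unnormalised as ℚᵘ
import Data.Rational.Unnormalised.Properties as ℚᵘ
open import Function using (_∘_)
open import Relation.Binary.Bundles using (Setoid)
open import Relation.Binary.Structures using (IsEquivalence)
import Relation.Binary.Reasoning.Setoid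
open import Relation.Binary.PropositionalEquality
open import Relation.Nullary using (Dec; yes; no; ¬_)
open import Relation.Nullary.Decidable using (_×-dec_)

open import Algebra.Properties.CommutativeSemigroup ℕ.+-commutativeSemigroup
  using () renaming (x∙yz≈y∙xz to ℕ-+-leftComm)
open import Algebra.Properties.CommutativeSemigroup (CommutativeMonoid.commutativeSemigroup ℚ.*-1-commutativeMonoid)
  using () renaming (x∙yz≈y∙xz to ℚ-*-leftComm)
module Monad = Data.List.Effectful.MonadProperties

term-cong : ∀ {c c' d d' v v'} → c ≡ c' → d ≡ d' → v ≡ v' → term c d v ≡ term c' d' v'
term-cong refl refl refl = refl

HasKey : Term → ℕ → Word → Set
HasKey r j w = tdeg r ≡ j × word r ≡ w

hasKey? : ∀ r j w → Dec (HasKey r j w)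
hasKey? r j w = (tdeg r ℕ.≟ j) ×-dec (List.≡-dec _≟L_ (word r) w)

coeffTerm : Term → ℕ → Word → ℚ
coeffTerm r = coeff (r ∷ [])

coeff-∷ : ∀ r p j w → coeff (r ∷ p) j w ≡ coeffTerm r j w ℚ.+ coeff p j w
coeff-∷ (term c d v) p j w with hasKey? (term c d v) j w
... | yes _ = cong (ℚ._+ coeff p j w) (sym (ℚ.+-identityʳ c))
... | no _  = sym (ℚ.+-identityˡ _)

coeffTerm-hit : ∀ r {j w} → HasKey r j w → coeffTerm r j w ≡ coef r
coeffTerm-hit (term c d v) {j} {w} key with hasKey? (term c d v) j w
... | yes _ = ℚ.+-identityʳ c
... | no ¬key = ⊥-elim (¬key key)

coeffTerm-miss : ∀ r {j w} → ¬ HasKey r j w → coeffTerm r j w ≡ 0ℚ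
coeffTerm-miss (term c d v) {j} {w} ¬key with hasKey? (term c d v) j w
... | yes key = ⊥-elim (¬key key)
... | no _ = refl

coeff-++ : ∀ p q j w → coeff (p ++ q) j w ≡ coeff p j w ℚ.+ coeff q j w
coeff-++ []      q j w = sym (ℚ.+-identityˡ _)
coeff-++ (r ∷ p) q j w = begin
  coeff (r ∷ p ++ q) j w                                ≡⟨ coeff-∷ r (p ++ q) j w ⟩
  coeffTerm r j w ℚ.+ coeff (p ++ q) j w                ≡⟨ cong (coeffTerm r j w ℚ.+_) (coeff-++ p q j w) ⟩
  coeffTerm r j w ℚ.+ (coeff p j w ℚ.+ coeff q j w)     ≡⟨ ℚ.+-assoc (coeffTerm r j w) _ _ ⟨
  (coeffTerm r j w ℚ.+ coeff p j w) ℚ.+ coeff q j w     ≡⟨ cong (ℚ._+ coeff q j w) (coeff-∷ r p j w) ⟨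
  coeff (r ∷ p) j w ℚ.+ coeff q j w                     ∎
  where open ≡-Reasoning

coeffTerm-transport : ∀ s r c {j w j' w'} → coef s ≡ c ℚ.* coef r →
  (HasKey s j w → HasKey r j' w') → (HasKey r j' w' → HasKey s j w) →
  coeffTerm s j w ≡ c ℚ.* coeffTerm r j' w'
coeffTerm-transport s r c {j} {w} {j'} {w'} coef≡ to from = by-cases (hasKey? r j' w')
  where
  open ≡-Reasoning
  by-cases : Dec (HasKey r j' w') → coeffTerm s j w ≡ c ℚ.* coeffTerm r j' w'
  by-cases (yes key) = begin
    coeffTerm s j w          ≡⟨ coeffTerm-hit s (from key) ⟩
    coef s                   ≡⟨ coef≡ ⟩
    c ℚ.* coef r             ≡⟨ cong (c ℚ.*_) (coeffTerm-hit r key) ⟨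
    c ℚ.* coeffTerm r j' w'  ∎
  by-cases (no ¬key) = begin
    coeffTerm s j w          ≡⟨ coeffTerm-miss s (¬key ∘ to) ⟩
    0ℚ                       ≡⟨ ℚ.*-zeroʳ c ⟨
    c ℚ.* 0ℚ                 ≡⟨ cong (c ℚ.*_) (coeffTerm-miss r ¬key) ⟨
    c ℚ.* coeffTerm r j' w'  ∎

coeff-map-hit : ∀ (f : Term → Term) c {j w j' w'} →
  (∀ r → coef (f r) ≡ c ℚ.* coef r) →
  (∀ r → HasKey (f r) j w → HasKey r j' w') → (∀ r → HasKey r j' w' → HasKey (f r) j w) →
  ∀ p → coeff (map f p) j w ≡ c ℚ.* coeff p j' w'
coeff-map-hit f c coef≡ to from []      = sym (ℚ.*-zeroʳ c)
coeff-map-hit f c {j} {w} {j'} {w'} coef≡ to from (r ∷ p) = begin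
  coeff (f r ∷ map f p) j w                            ≡⟨ coeff-∷ (f r) (map f p) j w ⟩
  coeffTerm (f r) j w ℚ.+ coeff (map f p) j w          ≡⟨ cong₂ ℚ._+_ (coeffTerm-transport (f r) r c (coef≡ r) (to r) (from r))
                                                                       (coeff-map-hit f c coef≡ to from p) ⟩
  c ℚ.* coeffTerm r j' w' ℚ.+ c ℚ.* coeff p j' w'      ≡⟨ ℚ.*-distribˡ-+ c _ _ ⟨
  c ℚ.* (coeffTerm r j' w' ℚ.+ coeff p j' w')          ≡⟨ cong (c ℚ.*_) (coeff-∷ r p j' w') ⟨
  c ℚ.* coeff (r ∷ p) j' w'                            ∎
  where open ≡-Reasoning

coeff-map-miss : ∀ (f : Term → Term) {j w} → (∀ r → ¬ HasKey (f r) j w) →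
  ∀ p → coeff (map f p) j w ≡ 0ℚ
coeff-map-miss f miss []      = refl
coeff-map-miss f {j} {w} miss (r ∷ p) = begin
  coeff (f r ∷ map f p) j w                    ≡⟨ coeff-∷ (f r) (map f p) j w ⟩
  coeffTerm (f r) j w ℚ.+ coeff (map f p) j w  ≡⟨ cong₂ ℚ._+_ (coeffTerm-miss (f r) (miss r)) (coeff-map-miss f miss p) ⟩
  0ℚ                                           ∎
  where open ≡-Reasoning

-- _≈_ unfolds to a function type, from which Agda cannot infer the two polynomials.
infix 4 _≋_
record _≋_ (p q : Poly) : Set where
  constructor mk≋
  field ≋⇒≈ : p ≈ q
open _≋_ public

≋-refl : ∀ {p} → p ≋ p
≋-refl = mk≋ λ _ _ → refl

≋-reflexive : ∀ {p q} → p ≡ q → p ≋ q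
≋-reflexive refl = ≋-refl

≋-sym : ∀ {p q} → p ≋ q → q ≋ p
≋-sym (mk≋ p≈q) = mk≋ λ j w → sym (p≈q j w)

≋-trans : ∀ {p q r} → p ≋ q → q ≋ r → p ≋ r
≋-trans (mk≋ p≈q) (mk≋ q≈r) = mk≋ λ j w → trans (p≈q j w) (q≈r j w)

≋-isEquivalence : IsEquivalence _≋_
≋-isEquivalence = record { refl = ≋-refl ; sym = ≋-sym ; trans = ≋-trans }

≋-setoid : Setoid _ _
≋-setoid = record { isEquivalence = ≋-isEquivalence }

module ≋-Reasoning = Relation.Binary.Reasoning.Setoid ≋-setoid

+P-cong : ∀ {p p' q q'} → p ≋ p' → q ≋ q' → p +P q ≋ p' +P q'
+P-cong {p} {p'} {q} {q'} (mk≋ p≈p') (mk≋ q≈q') = mk≋ λ j w → begin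
  coeff (p ++ q) j w               ≡⟨ coeff-++ p q j w ⟩
  coeff p j w ℚ.+ coeff q j w      ≡⟨ cong₂ ℚ._+_ (p≈p' j w) (q≈q' j w) ⟩
  coeff p' j w ℚ.+ coeff q' j w    ≡⟨ coeff-++ p' q' j w ⟨
  coeff (p' ++ q') j w             ∎
  where open ≡-Reasoning

+P-comm : ∀ p q → p +P q ≋ q +P p
+P-comm p q = mk≋ λ j w → begin
  coeff (p ++ q) j w               ≡⟨ coeff-++ p q j w ⟩
  coeff p j w ℚ.+ coeff q j w      ≡⟨ ℚ.+-comm (coeff p j w) _ ⟩
  coeff q j w ℚ.+ coeff p j w      ≡⟨ coeff-++ q p j w ⟨
  coeff (q ++ p) j w               ∎
  where open ≡-Reasoning

+P-isCommutativeMonoid : IsCommutativeMonoid _≋_ _+P_ 0P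
+P-isCommutativeMonoid = record
  { isMonoid = record
    { isSemigroup = record
      { isMagma = record { isEquivalence = ≋-isEquivalence ; ∙-cong = +P-cong }
      ; assoc = λ p q r → ≋-reflexive (List.++-assoc p q r)
      }
    ; identity = (λ _ → ≋-refl) , (λ p → ≋-reflexive (List.++-identityʳ p))
    }
  ; comm = +P-comm
  }

+P-commutativeMonoid : CommutativeMonoid _ _
+P-commutativeMonoid = record { isCommutativeMonoid = +P-isCommutativeMonoid }

open import Algebra.Properties.CommutativeSemigroup (CommutativeMonoid.commutativeSemigroup +P-commutativeMonoid)
  using (interchange; x∙yz≈yx∙z)

lmul : Word → Poly → Poly
lmul u = map (λ r → term (coef r) (tdeg r) (u ++ word r))

lmul-[] : ∀ P → lmul [] P ≡ P
lmul-[] = List.map-id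

lmul-∷ : ∀ l u P → lmul (l ∷ u) P ≡ lmul (l ∷ []) (lmul u P)
lmul-∷ l u = List.map-∘

lmul-lmul : ∀ u v P → lmul u (lmul v P) ≡ lmul (u ++ v) P
lmul-lmul u v P = begin
  lmul u (lmul v P)                                                 ≡⟨ List.map-∘ P ⟨
  map (λ r → term (coef r) (tdeg r) (u ++ (v ++ word r))) P         ≡⟨ List.map-cong (λ r → cong (term (coef r) (tdeg r)) (List.++-assoc u v (word r))) P ⟨
  lmul (u ++ v) P                                                   ∎
  where open ≡-Reasoning

coeff-lmul-letter-hit : ∀ l P j u → coeff (lmul (l ∷ []) P) j (l ∷ u) ≡ coeff P j u
coeff-lmul-letter-hit l P j u =
  trans (coeff-map-hit _ 1ℚ (λ r → sym (ℚ.*-identityˡ (coef r)))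
                        (λ r (d≡j , lv≡lu) → d≡j , List.∷-injectiveʳ lv≡lu)
                        (λ r (d≡j , v≡u) → d≡j , cong (l ∷_) v≡u) P)
        (ℚ.*-identityˡ _)

coeff-lmul-letter-miss : ∀ l P j w → (∀ u → w ≢ l ∷ u) → coeff (lmul (l ∷ []) P) j w ≡ 0ℚ
coeff-lmul-letter-miss l P j w w≢l∷ = coeff-map-miss _ (λ r (_ , lv≡w) → w≢l∷ (word r) (sym lv≡w)) P

lmul-letter-cong : ∀ l {P Q} → P ≋ Q → lmul (l ∷ []) P ≋ lmul (l ∷ []) Q
lmul-letter-cong l {P} {Q} (mk≋ P≈Q) = mk≋ coeff≡
  where
  coeff≡ : lmul (l ∷ []) P ≈ lmul (l ∷ []) Q
  coeff≡ j [] = trans (coeff-lmul-letter-miss l P j [] λ _ ()) (sym (coeff-lmul-letter-miss l Q j [] λ _ ()))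
  coeff≡ j (b ∷ u) with l ≟L b
  ... | yes refl = trans (coeff-lmul-letter-hit l P j u) (trans (P≈Q j u) (sym (coeff-lmul-letter-hit l Q j u)))
  ... | no l≢b = trans (coeff-lmul-letter-miss l P j (b ∷ u) b≢l) (sym (coeff-lmul-letter-miss l Q j (b ∷ u) b≢l))
    where
    b≢l : ∀ v → b ∷ u ≢ l ∷ v
    b≢l v eq = l≢b (sym (List.∷-injectiveˡ eq))

lmul-cong : ∀ u {P Q} → P ≋ Q → lmul u P ≋ lmul u Q
lmul-cong []      {P} {Q} P≋Q = begin
  lmul [] P  ≡⟨ lmul-[] P ⟩
  P          ≈⟨ P≋Q ⟩
  Q          ≡⟨ lmul-[] Q ⟨
  lmul [] Q  ∎
  where open ≋-Reasoning
lmul-cong (l ∷ u) {P} {Q} P≋Q = begin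
  lmul (l ∷ u) P              ≡⟨ lmul-∷ l u P ⟩
  lmul (l ∷ []) (lmul u P)    ≈⟨ lmul-letter-cong l (lmul-cong u P≋Q) ⟩
  lmul (l ∷ []) (lmul u Q)    ≡⟨ lmul-∷ l u Q ⟨
  lmul (l ∷ u) Q              ∎
  where open ≋-Reasoning

coeff-scale-hit : ∀ c d P {j} w → d ≤ j → coeff (scale c d P) j w ≡ c ℚ.* coeff P (j ∸ d) w
coeff-scale-hit c d P w d≤j = coeff-map-hit _ c (λ _ → refl)
  (λ r (d+e≡j , v≡w) → trans (sym (ℕ.m+n∸m≡n d (tdeg r))) (cong (_∸ d) d+e≡j) , v≡w)
  (λ r (e≡j∸d , v≡w) → trans (cong (d ℕ.+_) e≡j∸d) (ℕ.m+[n∸m]≡n d≤j) , v≡w) P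

coeff-scale-miss : ∀ c d P {j} w → j < d → coeff (scale c d P) j w ≡ 0ℚ
coeff-scale-miss c d P w j<d =
  coeff-map-miss _ (λ r (d+e≡j , _) → ℕ.<⇒≱ j<d (subst (d ≤_) d+e≡j (ℕ.m≤m+n d (tdeg r)))) P

scale-cong : ∀ c d {P Q} → P ≋ Q → scale c d P ≋ scale c d Q
scale-cong c d {P} {Q} (mk≋ P≈Q) = mk≋ coeff≡
  where
  coeff≡ : scale c d P ≈ scale c d Q
  coeff≡ j w with d ℕ.≤? j
  ... | yes d≤j = trans (coeff-scale-hit c d P w d≤j)
                    (trans (cong (c ℚ.*_) (P≈Q (j ∸ d) w)) (sym (coeff-scale-hit c d Q w d≤j)))
  ... | no d≰j = trans (coeff-scale-miss c d P w (ℕ.≰⇒> d≰j)) (sym (coeff-scale-miss c d Q w (ℕ.≰⇒> d≰j)))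

scale-distribʳ : ∀ c c' d P → scale c d P +P scale c' d P ≋ scale (c ℚ.+ c') d P
scale-distribʳ c c' d P = mk≋ coeff≡
  where
  coeff≡ : (scale c d P +P scale c' d P) ≈ scale (c ℚ.+ c') d P
  coeff≡ j w with d ℕ.≤? j
  ... | yes d≤j = begin
    coeff (scale c d P ++ scale c' d P) j w                     ≡⟨ coeff-++ (scale c d P) _ j w ⟩
    coeff (scale c d P) j w ℚ.+ coeff (scale c' d P) j w        ≡⟨ cong₂ ℚ._+_ (coeff-scale-hit c d P w d≤j) (coeff-scale-hit c' d P w d≤j) ⟩
    c ℚ.* coeff P (j ∸ d) w ℚ.+ c' ℚ.* coeff P (j ∸ d) w        ≡⟨ ℚ.*-distribʳ-+ _ c c' ⟨
    (c ℚ.+ c') ℚ.* coeff P (j ∸ d) w                            ≡⟨ coeff-scale-hit (c ℚ.+ c') d P w d≤j ⟨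
    coeff (scale (c ℚ.+ c') d P) j w                            ∎
    where open ≡-Reasoning
  ... | no d≰j = begin
    coeff (scale c d P ++ scale c' d P) j w                     ≡⟨ coeff-++ (scale c d P) _ j w ⟩
    coeff (scale c d P) j w ℚ.+ coeff (scale c' d P) j w        ≡⟨ cong₂ ℚ._+_ (coeff-scale-miss c d P w (ℕ.≰⇒> d≰j))
                                                                               (coeff-scale-miss c' d P w (ℕ.≰⇒> d≰j)) ⟩
    0ℚ                                                          ≡⟨ coeff-scale-miss (c ℚ.+ c') d P w (ℕ.≰⇒> d≰j) ⟨
    coeff (scale (c ℚ.+ c') d P) j w                            ∎
    where open ≡-Reasoning

scale-zeroˡ : ∀ d P → scale 0ℚ d P ≋ 0P
scale-zeroˡ d P = mk≋ coeff≡
  where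
  coeff≡ : scale 0ℚ d P ≈ 0P
  coeff≡ j w with d ℕ.≤? j
  ... | yes d≤j = trans (coeff-scale-hit 0ℚ d P w d≤j) (ℚ.*-zeroˡ (coeff P (j ∸ d) w))
  ... | no d≰j = coeff-scale-miss 0ℚ d P w (ℕ.≰⇒> d≰j)

scale-identity : ∀ P → scale 1ℚ 0 P ≡ P
scale-identity P = trans (List.map-cong (λ r → cong (λ c → term c (tdeg r) (word r)) (ℚ.*-identityˡ (coef r))) P) (List.map-id P)

scale-scale : ∀ c d c' d' P → scale c d (scale c' d' P) ≡ scale (c ℚ.* c') (d ℕ.+ d') P
scale-scale c d c' d' P = trans (sym (List.map-∘ P))
  (List.map-cong (λ r → cong₂ (λ e f → term e f (word r)) (sym (ℚ.*-assoc c c' (coef r))) (sym (ℕ.+-assoc d d' (tdeg r)))) P)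

scale-lmul : ∀ c d u P → scale c d (lmul u P) ≡ lmul u (scale c d P)
scale-lmul c d u P = trans (sym (List.map-∘ P)) (List.map-∘ P)

∑ : ℕ → (ℕ → Poly) → Poly
∑ zero    f = 0P
∑ (suc n) f = f 0 +P ∑ n (f ∘ suc)

sumP-map-upTo : ∀ f n → sumP (map f (upTo n)) ≡ ∑ n f
sumP-map-upTo f n = trans (cong sumP (List.map-upTo f n)) (sumP-applyUpTo f n)
  where
  sumP-applyUpTo : ∀ f n → sumP (applyUpTo f n) ≡ ∑ n f
  sumP-applyUpTo f zero    = refl
  sumP-applyUpTo f (suc n) = cong (f 0 ++_) (sumP-applyUpTo (f ∘ suc) n)

∑-0P : ∀ n → ∑ n (λ _ → 0P) ≡ 0P
∑-0P zero    = refl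
∑-0P (suc n) = ∑-0P n

∑-cong : ∀ n {f g} → (∀ i → i < n → f i ≋ g i) → ∑ n f ≋ ∑ n g
∑-cong zero    f≋g = ≋-refl
∑-cong (suc n) f≋g = +P-cong (f≋g 0 (s≤s z≤n)) (∑-cong n λ i i<n → f≋g (suc i) (s≤s i<n))

∑-cong-≡ : ∀ n {f g} → (∀ i → f i ≡ g i) → ∑ n f ≡ ∑ n g
∑-cong-≡ zero    f≡g = refl
∑-cong-≡ (suc n) f≡g = cong₂ _+P_ (f≡g 0) (∑-cong-≡ n (f≡g ∘ suc))

∑-distrib : ∀ n f g → ∑ n (λ i → f i +P g i) ≋ ∑ n f +P ∑ n g
∑-distrib zero    f g = ≋-refl
∑-distrib (suc n) f g = begin
  (f 0 +P g 0) +P ∑ n (λ i → f (suc i) +P g (suc i))    ≈⟨ +P-cong ≋-refl (∑-distrib n (f ∘ suc) (g ∘ suc)) ⟩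
  (f 0 +P g 0) +P (∑ n (f ∘ suc) +P ∑ n (g ∘ suc))      ≈⟨ interchange (f 0) (g 0) _ _ ⟩
  (f 0 +P ∑ n (f ∘ suc)) +P (g 0 +P ∑ n (g ∘ suc))      ∎
  where open ≋-Reasoning

∑-last : ∀ n f → ∑ (suc n) f ≡ ∑ n f +P f n
∑-last zero    f = List.++-identityʳ (f 0)
∑-last (suc n) f = trans (cong (f 0 ++_) (∑-last n (f ∘ suc))) (sym (List.++-assoc (f 0) _ _))

map-∑ : ∀ (h : Term → Term) n f → map h (∑ n f) ≡ ∑ n (map h ∘ f)
map-∑ h zero    f = refl
map-∑ h (suc n) f = trans (List.map-++ h (f 0) _) (cong (map h (f 0) ++_) (map-∑ h n (f ∘ suc)))

lmul-∑ : ∀ u n f → lmul u (∑ n f) ≡ ∑ n (lmul u ∘ f)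
lmul-∑ u = map-∑ _

scale-∑ : ∀ c d n f → scale c d (∑ n f) ≡ ∑ n (scale c d ∘ f)
scale-∑ c d = map-∑ _

map-sumP : ∀ {A : Set} (h : Term → Term) (f : A → Poly) L → map h (sumP (map f L)) ≡ sumP (map (map h ∘ f) L)
map-sumP h f []      = refl
map-sumP h f (i ∷ L) = trans (List.map-++ h (f i) _) (cong (map h (f i) ++_) (map-sumP h f L))

sumP-map-concatMap : ∀ {A B : Set} (f : B → Poly) (g : A → List B) L →
  sumP (map f (concatMap g L)) ≡ sumP (map (λ i → sumP (map f (g i))) L)
sumP-map-concatMap f g []      = refl
sumP-map-concatMap f g (i ∷ L) = begin
  sumP (map f (g i ++ concatMap g L))                          ≡⟨ cong sumP (List.map-++ f (g i) _) ⟩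
  sumP (map f (g i) ++ map f (concatMap g L))                  ≡⟨ sumP-++ (map f (g i)) _ ⟩
  sumP (map f (g i)) ++ sumP (map f (concatMap g L))           ≡⟨ cong (sumP (map f (g i)) ++_) (sumP-map-concatMap f g L) ⟩
  sumP (map f (g i)) ++ sumP (map (λ i → sumP (map f (g i))) L) ∎
  where
  open ≡-Reasoning
  sumP-++ : ∀ A B → sumP (A ++ B) ≡ sumP A ++ sumP B
  sumP-++ []      B = refl
  sumP-++ (p ∷ A) B = trans (cong (p ++_) (sumP-++ A B)) (sym (List.++-assoc p _ _))

mul : Term → Term → Term
mul s r = term (coef s ℚ.* coef r) (tdeg s ℕ.+ tdeg r) (word s ++ word r)

mul-assoc : ∀ s r u → mul (mul s r) u ≡ mul s (mul r u)
mul-assoc s r u = term-cong (ℚ.*-assoc (coef s) (coef r) (coef u)) (ℕ.+-assoc (tdeg s) (tdeg r) (tdeg u)) (List.++-assoc (word s) (word r) (word u))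

*P-assoc : ∀ p q r → (p *P q) *P r ≡ p *P (q *P r)
*P-assoc p q r = begin
  concatMap (λ u → map (mul u) r) (concatMap (λ s → map (mul s) q) p)
    ≡⟨ Monad.associative p (λ s → map (mul s) q) (λ u → map (mul u) r) ⟨
  concatMap (λ s → concatMap (λ u → map (mul u) r) (map (mul s) q)) p
    ≡⟨ List.concatMap-cong (λ s → List.concatMap-map (λ u → map (mul u) r) (mul s) q) p ⟩
  concatMap (λ s → concatMap (λ t → map (mul (mul s t)) r) q) p
    ≡⟨ List.concatMap-cong (λ s → List.concatMap-cong (λ t → trans (List.map-cong (mul-assoc s t) r) (List.map-∘ r)) q) p ⟩
  concatMap (λ s → concatMap (λ t → map (mul s) (map (mul t) r)) q) p
    ≡⟨ List.concatMap-cong (λ s → List.map-concatMap (mul s) (λ t → map (mul t) r) q) p ⟨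
  concatMap (λ s → map (mul s) (concatMap (λ t → map (mul t) r) q)) p
    ∎
  where open ≡-Reasoning

monomial : Word → Poly
monomial u = term 1ℚ 0 u ∷ []

monomial-*P : ∀ u P → monomial u *P P ≡ lmul u P
monomial-*P u P = trans (List.++-identityʳ _) (List.map-cong (λ r → cong (λ c → term c (tdeg r) (u ++ word r)) (ℚ.*-identityˡ (coef r))) P)

*P-identityʳ : ∀ P → P *P 1P ≡ P
*P-identityʳ []               = refl
*P-identityʳ (term c d v ∷ P) = cong₂ _∷_ (term-cong (ℚ.*-identityʳ c) (ℕ.+-identityʳ d) (List.++-identityʳ v)) (*P-identityʳ P)

prodP-++ : ∀ ps qs → prodP (ps ++ qs) ≡ prodP ps *P prodP qs
prodP-++ []       qs = sym (trans (monomial-*P [] (prodP qs)) (lmul-[] (prodP qs)))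
prodP-++ (p ∷ ps) qs = trans (cong (p *P_) (prodP-++ ps qs)) (sym (*P-assoc p (prodP ps) (prodP qs)))

*P-scale : ∀ p c d Q → p *P scale c d Q ≡ scale c d (p *P Q)
*P-scale p c d Q = begin
  concatMap (λ s → map (mul s) (scale c d Q)) p
    ≡⟨ List.concatMap-cong (λ s → trans (sym (List.map-∘ Q)) (List.map-cong (sym ∘ scale-mul s) Q)) p ⟩
  concatMap (λ s → map (λ r → scaleTerm (mul s r)) Q) p          ≡⟨ List.concatMap-cong (λ s → List.map-∘ Q) p ⟩
  concatMap (λ s → scale c d (map (mul s) Q)) p                   ≡⟨ List.map-concatMap scaleTerm (λ s → map (mul s) Q) p ⟨
  scale c d (p *P Q)                                              ∎
  where
  open ≡-Reasoning
  scaleTerm : Term → Term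
  scaleTerm r = term (c ℚ.* coef r) (d ℕ.+ tdeg r) (word r)
  scale-mul : ∀ s r → scaleTerm (mul s r) ≡ mul s (scaleTerm r)
  scale-mul s r = cong₂ (λ e f → term e f (word s ++ word r)) (ℚ-*-leftComm c (coef s) (coef r)) (ℕ-+-leftComm d (tdeg s) (tdeg r))

*P-distribˡ : ∀ p Q R → p *P (Q +P R) ≋ (p *P Q) +P (p *P R)
*P-distribˡ []      Q R = ≋-refl
*P-distribˡ (s ∷ p) Q R = begin
  map (mul s) (Q ++ R) ++ p *P (Q ++ R)                        ≡⟨ cong (_++ p *P (Q ++ R)) (List.map-++ (mul s) Q R) ⟩
  (map (mul s) Q ++ map (mul s) R) ++ p *P (Q ++ R)            ≈⟨ +P-cong ≋-refl (*P-distribˡ p Q R) ⟩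
  (map (mul s) Q ++ map (mul s) R) ++ (p *P Q ++ p *P R)       ≈⟨ interchange (map (mul s) Q) _ _ _ ⟩
  (map (mul s) Q ++ p *P Q) ++ (map (mul s) R ++ p *P R)       ∎
  where open ≋-Reasoning

xPow : ℕ → Word
xPow m = replicate m x

-- zWord m is x^m y = z_{m+1}, so z (a * k) is the monomial of zWord (a * k ∸ 1).
zWord : ℕ → Word
zWord m = xPow m ++ y ∷ []

xPow-++ : ∀ m n → xPow m ++ xPow n ≡ xPow (m ℕ.+ n)
xPow-++ zero    n = refl
xPow-++ (suc m) n = cong (x ∷_) (xPow-++ m n)

σW-++ : ∀ u v → σW (u ++ v) ≡ σW u *P σW v
σW-++ u v = trans (cong prodP (List.map-++ σL u v)) (prodP-++ (map σL u) (map σL v))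

σW-xPow : ∀ m → σW (xPow m) ≡ monomial (xPow m)
σW-xPow zero    = refl
σW-xPow (suc m) = trans (cong (letter x *P_) (σW-xPow m)) (monomial-*P (x ∷ []) _)

σW-zWord : ∀ m → σW (zWord m) ≡ term 1ℚ 1 (xPow (suc m)) ∷ monomial (zWord m)
σW-zWord m = begin
  σW (xPow m ++ y ∷ [])                         ≡⟨ σW-++ (xPow m) (y ∷ []) ⟩
  σW (xPow m) *P σW (y ∷ [])                    ≡⟨ cong₂ _*P_ (σW-xPow m) (*P-identityʳ (σL y)) ⟩
  monomial (xPow m) *P σL y                     ≡⟨ monomial-*P (xPow m) (σL y) ⟩
  lmul (xPow m) (σL y)                          ≡⟨ cong (λ v → term 1ℚ 1 v ∷ monomial (zWord m)) (xPow-++ m 1) ⟩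
  term 1ℚ 1 (xPow (m ℕ.+ 1)) ∷ monomial (zWord m) ≡⟨ cong (λ n → term 1ℚ 1 (xPow n) ∷ monomial (zWord m)) (ℕ.+-comm m 1) ⟩
  term 1ℚ 1 (xPow (suc m)) ∷ monomial (zWord m)  ∎
  where open ≡-Reasoning

initLast-∷ʳ : ∀ {A : Set} (v : List A) a → initLast (v ∷ʳ a) ≡ v ∷ʳ′ a
initLast-∷ʳ []      a = refl
initLast-∷ʳ (b ∷ v) a rewrite initLast-∷ʳ v a = refl

unsnoc-∷ʳ : ∀ {A : Set} (v : List A) a → unsnoc (v ∷ʳ a) ≡ just (v , a)
unsnoc-∷ʳ v a rewrite initLast-∷ʳ v a = refl

SW-∷ʳ : ∀ v a → SW (v ∷ʳ a) ≡ σW v *P letter a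
SW-∷ʳ v a rewrite unsnoc-∷ʳ v a = refl

SW-++-∷ʳ : ∀ u v a → SW (u ++ (v ∷ʳ a)) ≡ σW u *P SW (v ∷ʳ a)
SW-++-∷ʳ u v a = begin
  SW (u ++ (v ∷ʳ a))            ≡⟨ cong SW (List.++-assoc u v (a ∷ [])) ⟨
  SW ((u ++ v) ∷ʳ a)            ≡⟨ SW-∷ʳ (u ++ v) a ⟩
  σW (u ++ v) *P letter a       ≡⟨ cong (_*P letter a) (σW-++ u v) ⟩
  (σW u *P σW v) *P letter a    ≡⟨ *P-assoc (σW u) (σW v) (letter a) ⟩
  σW u *P (σW v *P letter a)    ≡⟨ cong (σW u *P_) (SW-∷ʳ v a) ⟨
  σW u *P SW (v ∷ʳ a)           ∎
  where open ≡-Reasoning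

SW-++ : ∀ u w → w ≢ [] → SW (u ++ w) ≡ σW u *P SW w
SW-++ u w = by-view w (initLast w)
  where
  by-view : ∀ w → InitLast w → w ≢ [] → SW (u ++ w) ≡ σW u *P SW w
  by-view .[]       []        w≢[] = ⊥-elim (w≢[] refl)
  by-view .(v ∷ʳ a) (v ∷ʳ′ a) _    = SW-++-∷ʳ u v a

NonEmptyWords : Poly → Set
NonEmptyWords = All (λ r → word r ≢ [])

-- S(u w) = σ(u) S(w) fails for w = [], where S(u) = σ(u′) a with u = u′ a.
S-lmul : ∀ u P → NonEmptyWords P → S (lmul u P) ≋ σW u *P S P
S-lmul u []      []            = ≋-reflexive (sym (Monad.right-zero (σW u)))
S-lmul u (r ∷ P) (w≢[] ∷ P≢[]) = begin
  scale c d (SW (u ++ word r)) +P S (lmul u P)          ≡⟨ cong (λ p → scale c d p +P S (lmul u P)) (SW-++ u (word r) w≢[]) ⟩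
  scale c d (σW u *P SW (word r)) +P S (lmul u P)       ≡⟨ cong (_+P S (lmul u P)) (*P-scale (σW u) c d (SW (word r))) ⟨
  (σW u *P scale c d (SW (word r))) +P S (lmul u P)     ≈⟨ +P-cong ≋-refl (S-lmul u P P≢[]) ⟩
  (σW u *P scale c d (SW (word r))) +P (σW u *P S P)    ≈⟨ *P-distribˡ (σW u) _ (S P) ⟨
  σW u *P (scale c d (SW (word r)) +P S P)              ∎
  where
  open ≋-Reasoning
  c : ℚ
  c = coef r
  d : ℕ
  d = tdeg r

tMul : Poly → Poly
tMul = scale 1ℚ 1

S-lmul-xPow : ∀ m P → NonEmptyWords P → S (lmul (xPow m) P) ≋ lmul (xPow m) (S P)
S-lmul-xPow m P P≢[] = begin
  S (lmul (xPow m) P)             ≈⟨ S-lmul (xPow m) P P≢[] ⟩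
  σW (xPow m) *P S P              ≡⟨ cong (_*P S P) (σW-xPow m) ⟩
  monomial (xPow m) *P S P        ≡⟨ monomial-*P (xPow m) (S P) ⟩
  lmul (xPow m) (S P)             ∎
  where open ≋-Reasoning

S-lmul-zWord : ∀ m P → NonEmptyWords P →
  S (lmul (zWord m) P) ≋ tMul (lmul (xPow (suc m)) (S P)) +P lmul (zWord m) (S P)
S-lmul-zWord m P P≢[] = begin
  S (lmul (zWord m) P)                                                  ≈⟨ S-lmul (zWord m) P P≢[] ⟩
  σW (zWord m) *P S P                                                   ≡⟨ cong (_*P S P) (σW-zWord m) ⟩
  map (mul (term 1ℚ 1 (xPow (suc m)))) (S P) +P (monomial (zWord m) *P S P)
    ≡⟨ cong₂ _+P_ (List.map-∘ (S P)) (monomial-*P (zWord m) (S P)) ⟩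
  tMul (lmul (xPow (suc m)) (S P)) +P lmul (zWord m) (S P)             ∎
  where open ≋-Reasoning

NonEmptyWords-++ : ∀ P Q → NonEmptyWords P → NonEmptyWords Q → NonEmptyWords (P +P Q)
NonEmptyWords-++ []      Q []            Q≢[] = Q≢[]
NonEmptyWords-++ (r ∷ P) Q (w≢[] ∷ P≢[]) Q≢[] = w≢[] ∷ NonEmptyWords-++ P Q P≢[] Q≢[]

NonEmptyWords-lmul : ∀ u P → NonEmptyWords P → NonEmptyWords (lmul u P)
NonEmptyWords-lmul u []      []            = []
NonEmptyWords-lmul u (r ∷ P) (w≢[] ∷ P≢[]) = (w≢[] ∘ List.++-conicalʳ u (word r)) ∷ NonEmptyWords-lmul u P P≢[]

NonEmptyWords-lmul-zWord : ∀ m P → NonEmptyWords (lmul (zWord m) P)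
NonEmptyWords-lmul-zWord m []      = []
NonEmptyWords-lmul-zWord m (r ∷ P) = y∷w≢[] ∘ List.++-conicalʳ (xPow m) _ ∘ trans (sym (List.++-assoc (xPow m) (y ∷ []) (word r)))
                                     ∷ NonEmptyWords-lmul-zWord m P
  where
  y∷w≢[] : y ∷ word r ≢ []
  y∷w≢[] ()

ZWords : Poly → Set
ZWords = All (λ r → Σ ℕ λ m → word r ≡ zWord m)

S-ZWords : ∀ P → ZWords P → S P ≡ P
S-ZWords []               []                = refl
S-ZWords (term c d v ∷ P) ((m , refl) ∷ Pz) = cong₂ _++_ S-zWord (S-ZWords P Pz)
  where
  open ≡-Reasoning
  S-zWord : scale c d (SW (zWord m)) ≡ term c d (zWord m) ∷ []
  S-zWord = begin
    scale c d (SW (xPow m ∷ʳ y))                     ≡⟨ cong (scale c d) (SW-∷ʳ (xPow m) y) ⟩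
    scale c d (σW (xPow m) *P letter y)              ≡⟨ cong (λ p → scale c d (p *P letter y)) (σW-xPow m) ⟩
    scale c d (monomial (xPow m) *P letter y)        ≡⟨ cong (scale c d) (monomial-*P (xPow m) (letter y)) ⟩
    term (c ℚ.* 1ℚ) (d ℕ.+ 0) (zWord m) ∷ []         ≡⟨ cong (_∷ []) (term-cong (ℚ.*-identityʳ c) (ℕ.+-identityʳ d) refl) ⟩
    term c d (zWord m) ∷ []                          ∎

ZWords-++ : ∀ P Q → ZWords P → ZWords Q → ZWords (P +P Q)
ZWords-++ []      Q []         Qz = Qz
ZWords-++ (r ∷ P) Q (rz ∷ Pz) Qz = rz ∷ ZWords-++ P Q Pz Qz

ZWords-lmul-xPow : ∀ m P → ZWords P → ZWords (lmul (xPow m) P)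
ZWords-lmul-xPow m []      []              = []
ZWords-lmul-xPow m (r ∷ P) ((n , w≡) ∷ Pz) = (m ℕ.+ n , prefixed) ∷ ZWords-lmul-xPow m P Pz
  where
  open ≡-Reasoning
  prefixed : xPow m ++ word r ≡ zWord (m ℕ.+ n)
  prefixed = begin
    xPow m ++ word r                 ≡⟨ cong (xPow m ++_) w≡ ⟩
    xPow m ++ (xPow n ++ y ∷ [])     ≡⟨ List.++-assoc (xPow m) (xPow n) _ ⟨
    (xPow m ++ xPow n) ++ y ∷ []     ≡⟨ cong (_++ y ∷ []) (xPow-++ m n) ⟩
    zWord (m ℕ.+ n)                  ∎

⌜_⌝ : ℕ → ℚ
⌜ n ⌝ = ℤ.+ n ℚ./ 1

⌜⌝-+ : ∀ m n → ⌜ m ⌝ ℚ.+ ⌜ n ⌝ ≡ ⌜ m ℕ.+ n ⌝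
⌜⌝-+ m n = begin
  ⌜ m ⌝ ℚ.+ ⌜ n ⌝                ≡⟨ cong₂ ℚ._+_ (⌜⌝≡mkℚ m) (⌜⌝≡mkℚ n) ⟩
  integer m ℚ.+ integer n        ≡⟨ ℚ.toℚᵘ-injective (ℚᵘ.≃-trans (ℚ.toℚᵘ-homo-+ (integer m) (integer n)) (ℚᵘ.*≡* cross-multiplied)) ⟩
  integer (m ℕ.+ n)              ≡⟨ ⌜⌝≡mkℚ (m ℕ.+ n) ⟨
  ⌜ m ℕ.+ n ⌝                    ∎
  where
  open ≡-Reasoning
  integer : ℕ → ℚ
  integer n = ℚ.mkℚ (ℤ.+ n) 0 (Coprime.sym (Coprime.1-coprimeTo n))
  ⌜⌝≡mkℚ : ∀ n → ⌜ n ⌝ ≡ integer n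
  ⌜⌝≡mkℚ n = ℚ.normalize-coprime (Coprime.sym (Coprime.1-coprimeTo n))
  cross-multiplied : (ℤ.+ m ℤ.* ℤ.+ 1 ℤ.+ ℤ.+ n ℤ.* ℤ.+ 1) ℤ.* ℤ.+ 1 ≡ ℤ.+ (m ℕ.+ n) ℤ.* (ℤ.+ 1 ℤ.* ℤ.+ 1)
  cross-multiplied rewrite ℤ.*-identityʳ (ℤ.+ m) | ℤ.*-identityʳ (ℤ.+ n) | ℤ.*-identityʳ (ℤ.+ m ℤ.+ ℤ.+ n) = sym (ℤ.pos-+ m n)

scale-pascal : ∀ t d P → scale ⌜ suc t C suc d ⌝ (suc d) P ≋ tMul (scale ⌜ t C d ⌝ d P) +P scale ⌜ t C suc d ⌝ (suc d) P
scale-pascal t d P = begin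
  scale ⌜ suc t C suc d ⌝ (suc d) P
    ≡⟨ cong (λ c → scale c (suc d) P) (trans (⌜⌝-+ (t C d) (t C suc d)) (cong ⌜_⌝ (nCk+nC[k+1]≡[n+1]C[k+1] t d))) ⟨
  scale (⌜ t C d ⌝ ℚ.+ ⌜ t C suc d ⌝) (suc d) P                      ≈⟨ scale-distribʳ ⌜ t C d ⌝ ⌜ t C suc d ⌝ (suc d) P ⟨
  scale ⌜ t C d ⌝ (suc d) P +P scale ⌜ t C suc d ⌝ (suc d) P          ≡⟨ cong (_+P scale ⌜ t C suc d ⌝ (suc d) P) t·scale ⟨
  tMul (scale ⌜ t C d ⌝ d P) +P scale ⌜ t C suc d ⌝ (suc d) P        ∎
  where
  open ≋-Reasoning
  t·scale : tMul (scale ⌜ t C d ⌝ d P) ≡ scale ⌜ t C d ⌝ (suc d) P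
  t·scale = trans (scale-scale 1ℚ 1 ⌜ t C d ⌝ d P) (cong (λ c → scale c (suc d) P) (ℚ.*-identityˡ ⌜ t C d ⌝))

binomScale : ℕ → ℕ → ℕ → Poly → Poly
binomScale k n i = scale ⌜ (k ∸ suc i) C (n ∸ suc i) ⌝ (n ∸ suc i)

binomScale-lmul : ∀ k n i u P → binomScale k n i (lmul u P) ≡ lmul u (binomScale k n i P)
binomScale-lmul k n i = scale-lmul ⌜ (k ∸ suc i) C (n ∸ suc i) ⌝ (n ∸ suc i)

binomScale-last : ∀ k n P → binomScale k (suc n) n P ≡ P
binomScale-last k n P rewrite ℕ.n∸n≡0 n = scale-identity P

-- For k ≤ i the truncated differences break Pascal's rule; there P must vanish instead.
binomScale-pascal : ∀ k n i P → i ≤ n → (k ≤ i → P ≡ 0P) →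
  binomScale (suc k) (suc (suc n)) i P ≋ tMul (binomScale k (suc n) i P) +P binomScale k (suc (suc n)) i P
binomScale-pascal k n i P i≤n vanishes with i ℕ.<? k
... | yes i<k = pascal-at (k ∸ suc i) (n ∸ i) (ℕ.+-∸-assoc 1 i<k) (ℕ.+-∸-assoc 1 i≤n)
  where
  pascal-at : ∀ {K M} t d → K ≡ suc t → M ≡ suc d →
    scale ⌜ K C M ⌝ M P ≋ tMul (scale ⌜ t C d ⌝ d P) +P scale ⌜ t C M ⌝ M P
  pascal-at t d refl refl = scale-pascal t d P
... | no i≮k rewrite vanishes (ℕ.≮⇒≥ i≮k) = ≋-refl

[k∸i]∸[k∸n]≡n∸i : ∀ i n k → i ≤ n → n ≤ k → (k ∸ i) ∸ (k ∸ n) ≡ n ∸ i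
[k∸i]∸[k∸n]≡n∸i zero    n       k       _         n≤k       = ℕ.m∸[m∸n]≡n n≤k
[k∸i]∸[k∸n]≡n∸i (suc i) (suc n) (suc k) (s≤s i≤n) (s≤s n≤k) = [k∸i]∸[k∸n]≡n∸i i n k i≤n n≤k

C-complement : ∀ i n k → i ≤ n → n ≤ k → (k ∸ i) C (k ∸ n) ≡ (k ∸ i) C (n ∸ i)
C-complement i n k i≤n n≤k = trans (nCk≡nC[n∸k] (ℕ.∸-monoʳ-≤ k i≤n)) (cong ((k ∸ i) C_) ([k∸i]∸[k∸n]≡n∸i i n k i≤n n≤k))

module _ (a-1 : ℕ) where

  private
    a : ℕ
    a = suc a-1

  X Z : Poly → Poly
  X = lmul (xPow a)
  Z = lmul (zWord a-1)

  zProduct : List ℕ → Poly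
  zProduct ks = prodP (map (λ kᵢ → z (a ℕ.* kᵢ)) ks)

  N-by-first-part : ∀ k n → N a k (suc n) ≡ ∑ k (λ i → lmul (zWord (a ℕ.* suc i ∸ 1)) (N a (k ∸ suc i) n))
  N-by-first-part zero    n = refl
  N-by-first-part (suc k) n = begin
    sumP (map zProduct (concatMap prepend (upTo (suc k))))
      ≡⟨ sumP-map-concatMap zProduct prepend (upTo (suc k)) ⟩
    sumP (map (λ i → sumP (map zProduct (prepend i))) (upTo (suc k)))
      ≡⟨ cong sumP (List.map-cong first-part (upTo (suc k))) ⟩
    sumP (map (λ i → lmul (zWord (a ℕ.* suc i ∸ 1)) (N a (suc k ∸ suc i) n)) (upTo (suc k)))
      ≡⟨ sumP-map-upTo _ (suc k) ⟩
    ∑ (suc k) (λ i → lmul (zWord (a ℕ.* suc i ∸ 1)) (N a (suc k ∸ suc i) n))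
      ∎
    where
    open ≡-Reasoning
    prepend : ℕ → List (List ℕ)
    prepend i = map (suc i ∷_) (compositions (suc k ∸ suc i) n)
    first-part : ∀ i → sumP (map zProduct (prepend i)) ≡ lmul (zWord (a ℕ.* suc i ∸ 1)) (N a (suc k ∸ suc i) n)
    first-part i = begin
      sumP (map zProduct (prepend i))                            ≡⟨ cong sumP (List.map-∘ Ks) ⟨
      sumP (map (λ ks → z (a ℕ.* suc i) *P zProduct ks) Ks)      ≡⟨ cong sumP (List.map-cong (λ ks → monomial-*P zw (zProduct ks)) Ks) ⟩
      sumP (map (λ ks → lmul zw (zProduct ks)) Ks)               ≡⟨ map-sumP _ zProduct Ks ⟨
      lmul zw (N a (suc k ∸ suc i) n)                            ∎
      where
      Ks : List (List ℕ)
      Ks = compositions (suc k ∸ suc i) n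
      zw : Word
      zw = zWord (a ℕ.* suc i ∸ 1)

  xPow-zWord : ∀ i → xPow a ++ zWord (a ℕ.* suc i ∸ 1) ≡ zWord (a ℕ.* suc (suc i) ∸ 1)
  xPow-zWord i = begin
    xPow a ++ (xPow (a ℕ.* suc i ∸ 1) ++ y ∷ [])      ≡⟨ List.++-assoc (xPow a) _ _ ⟨
    (xPow a ++ xPow (a ℕ.* suc i ∸ 1)) ++ y ∷ []      ≡⟨ cong (_++ y ∷ []) (xPow-++ a _) ⟩
    zWord (a ℕ.+ (a ℕ.* suc i ∸ 1))                   ≡⟨ cong zWord (ℕ.+-∸-assoc a (s≤s z≤n)) ⟨
    zWord (a ℕ.+ a ℕ.* suc i ∸ 1)                     ≡⟨ cong (λ m → zWord (m ∸ 1)) (ℕ.*-suc a (suc i)) ⟨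
    zWord (a ℕ.* suc (suc i) ∸ 1)                     ∎
    where open ≡-Reasoning

  N-suc-suc : ∀ k n → N a (suc k) (suc n) ≡ Z (N a k n) +P X (N a k (suc n))
  N-suc-suc k n = begin
    N a (suc k) (suc n)
      ≡⟨ N-by-first-part (suc k) n ⟩
    lmul (zWord (a ℕ.* 1 ∸ 1)) (N a k n) +P higher
      ≡⟨ cong (λ m → lmul (zWord m) (N a k n) +P higher) (ℕ.*-identityʳ a-1) ⟩
    Z (N a k n) +P higher
      ≡⟨ cong (Z (N a k n) +P_) (∑-cong-≡ k λ i → trans (lmul-lmul (xPow a) _ _) (cong (λ w → lmul w (N a (k ∸ suc i) n)) (xPow-zWord i))) ⟨
    Z (N a k n) +P ∑ k (λ i → X (lmul (zWord (a ℕ.* suc i ∸ 1)) (N a (k ∸ suc i) n)))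
      ≡⟨ cong (Z (N a k n) +P_) (trans (cong X (N-by-first-part k n)) (lmul-∑ (xPow a) k _)) ⟨
    Z (N a k n) +P X (N a k (suc n))
      ∎
    where
    open ≡-Reasoning
    higher : Poly
    higher = ∑ k (λ i → lmul (zWord (a ℕ.* suc (suc i) ∸ 1)) (N a (k ∸ suc i) n))

  N-nonEmptyWords : ∀ k n → NonEmptyWords (N a k (suc n))
  N-nonEmptyWords zero    n = []
  N-nonEmptyWords (suc k) n = subst NonEmptyWords (sym (N-suc-suc k n))
    (NonEmptyWords-++ _ _ (NonEmptyWords-lmul-zWord a-1 (N a k n)) (NonEmptyWords-lmul (xPow a) _ (N-nonEmptyWords k n)))

  N-vanishes : ∀ k n → k ≤ n → N a k (suc n) ≡ 0P
  N-vanishes zero    n       _         = refl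
  N-vanishes (suc k) (suc n) (s≤s k≤n) = begin
    N a (suc k) (suc (suc n))                   ≡⟨ N-suc-suc k (suc n) ⟩
    Z (N a k (suc n)) +P X (N a k (suc (suc n))) ≡⟨ cong₂ (λ p q → Z p +P X q) (N-vanishes k n k≤n) (N-vanishes k (suc n) (ℕ.m≤n⇒m≤1+n k≤n)) ⟩
    0P                                          ∎
    where open ≡-Reasoning

  Z-N₀-zWords : ∀ k → ZWords (Z (N a k 0))
  Z-N₀-zWords zero    = (a-1 , List.++-identityʳ (zWord a-1)) ∷ []
  Z-N₀-zWords (suc k) = []

  N-zWords : ∀ k → ZWords (N a k 1)
  N-zWords zero    = []
  N-zWords (suc k) = subst ZWords (sym (N-suc-suc k 0)) (ZWords-++ _ _ (Z-N₀-zWords k) (ZWords-lmul-xPow a _ (N-zWords k)))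

  S-N-suc-suc : ∀ k n →
    S (N a (suc k) (suc (suc n))) ≋ (tMul (X (S (N a k (suc n)))) +P Z (S (N a k (suc n)))) +P X (S (N a k (suc (suc n))))
  S-N-suc-suc k n = begin
    S (N a (suc k) (suc (suc n)))              ≡⟨ cong S (N-suc-suc k (suc n)) ⟩
    S (Z (N a k (suc n)) +P X (N a k (suc (suc n))))  ≡⟨ List.concatMap-++ _ (Z (N a k (suc n))) _ ⟩
    S (Z (N a k (suc n))) +P S (X (N a k (suc (suc n))))
      ≈⟨ +P-cong (S-lmul-zWord a-1 _ (N-nonEmptyWords k n)) (S-lmul-xPow a _ (N-nonEmptyWords k (suc n))) ⟩
    (tMul (X (S (N a k (suc n)))) +P Z (S (N a k (suc n)))) +P X (S (N a k (suc (suc n)))) ∎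
    where open ≋-Reasoning

  -- The paper's right-hand side shifted to i + 1 and with C(k-i, k-n) = C(k-i, n-i) (RHS≋rhs),
  -- the form in which Pascal's rule applies in k and n simultaneously.
  rhsTerm : ℕ → ℕ → ℕ → Poly
  rhsTerm k n i = binomScale k n i (N a k (suc i))

  rhs : ℕ → ℕ → Poly
  rhs k n = ∑ n (rhsTerm k n)

  scale-N₀-vanishes : ∀ k n → scale ⌜ k C suc n ⌝ (suc n) (Z (N a k 0)) ≋ 0P
  scale-N₀-vanishes zero    n = scale-zeroˡ (suc n) (Z (N a 0 0))
  scale-N₀-vanishes (suc k) n = ≋-refl

  rhs-z-part : ∀ k n → ∑ (suc (suc n)) (λ i → binomScale (suc k) (suc (suc n)) i (Z (N a k i))) ≋ Z (rhs k (suc n))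
  rhs-z-part k n = begin
    zTerm 0 +P ∑ (suc n) (zTerm ∘ suc)                 ≈⟨ +P-cong (scale-N₀-vanishes k n) ≋-refl ⟩
    ∑ (suc n) (zTerm ∘ suc)                            ≡⟨ ∑-cong-≡ (suc n) (λ i → binomScale-lmul k (suc n) i (zWord a-1) (N a k (suc i))) ⟩
    ∑ (suc n) (Z ∘ rhsTerm k (suc n))                  ≡⟨ lmul-∑ (zWord a-1) (suc n) (rhsTerm k (suc n)) ⟨
    Z (rhs k (suc n))                                  ∎
    where
    open ≋-Reasoning
    zTerm : ℕ → Poly
    zTerm i = binomScale (suc k) (suc (suc n)) i (Z (N a k i))

  rhs-x-part : ∀ k n → ∑ (suc (suc n)) (λ i → binomScale (suc k) (suc (suc n)) i (X (N a k (suc i))))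
                        ≋ tMul (X (rhs k (suc n))) +P X (rhs k (suc (suc n)))
  rhs-x-part k n = begin
    ∑ (suc (suc n)) xTerm
      ≡⟨ ∑-last (suc n) xTerm ⟩
    ∑ (suc n) xTerm +P xTerm (suc n)
      ≈⟨ +P-cong (∑-cong (suc n) xTerm-pascal) (≋-reflexive (binomScale-last (suc k) (suc n) _)) ⟩
    ∑ (suc n) (λ i → tMul (X (rhsTerm k (suc n) i)) +P X (rhsTerm k (suc (suc n)) i)) +P X (N a k (suc (suc n)))
      ≈⟨ +P-cong (∑-distrib (suc n) (tMul ∘ X ∘ rhsTerm k (suc n)) (X ∘ rhsTerm k (suc (suc n)))) ≋-refl ⟩
    (∑ (suc n) (tMul ∘ X ∘ rhsTerm k (suc n)) +P ∑ (suc n) (X ∘ rhsTerm k (suc (suc n)))) +P X (N a k (suc (suc n)))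
      ≡⟨ List.++-assoc (∑ (suc n) (tMul ∘ X ∘ rhsTerm k (suc n))) _ _ ⟩
    ∑ (suc n) (tMul ∘ X ∘ rhsTerm k (suc n)) +P (∑ (suc n) (X ∘ rhsTerm k (suc (suc n))) +P X (N a k (suc (suc n))))
      ≡⟨ cong₂ _+P_ (trans (cong tMul (lmul-∑ (xPow a) (suc n) (rhsTerm k (suc n)))) (scale-∑ 1ℚ 1 (suc n) (X ∘ rhsTerm k (suc n))))
                    (cong (_+P X (N a k (suc (suc n)))) (lmul-∑ (xPow a) (suc n) (rhsTerm k (suc (suc n))))) ⟨
    tMul (X (rhs k (suc n))) +P (X (∑ (suc n) (rhsTerm k (suc (suc n)))) +P X (N a k (suc (suc n))))
      ≈⟨ +P-cong ≋-refl X-rhs-last ⟨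
    tMul (X (rhs k (suc n))) +P X (rhs k (suc (suc n))) ∎
    where
    open ≋-Reasoning
    xTerm : ℕ → Poly
    xTerm i = binomScale (suc k) (suc (suc n)) i (X (N a k (suc i)))

    xTerm-pascal : ∀ i → i < suc n → xTerm i ≋ tMul (X (rhsTerm k (suc n) i)) +P X (rhsTerm k (suc (suc n)) i)
    xTerm-pascal i i<1+n = begin
      xTerm i
        ≈⟨ binomScale-pascal k n i (X (N a k (suc i))) (ℕ.≤-pred i<1+n) (λ k≤i → cong X (N-vanishes k i k≤i)) ⟩
      tMul (binomScale k (suc n) i (X (N a k (suc i)))) +P binomScale k (suc (suc n)) i (X (N a k (suc i)))
        ≡⟨ cong₂ (λ p q → tMul p +P q) (binomScale-lmul k (suc n) i (xPow a) (N a k (suc i)))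
                                       (binomScale-lmul k (suc (suc n)) i (xPow a) (N a k (suc i))) ⟩
      tMul (X (rhsTerm k (suc n) i)) +P X (rhsTerm k (suc (suc n)) i) ∎

    X-rhs-last : X (rhs k (suc (suc n))) ≋ X (∑ (suc n) (rhsTerm k (suc (suc n)))) +P X (N a k (suc (suc n)))
    X-rhs-last = begin
      X (rhs k (suc (suc n)))
        ≡⟨ cong X (∑-last (suc n) (rhsTerm k (suc (suc n)))) ⟩
      X (∑ (suc n) (rhsTerm k (suc (suc n))) +P rhsTerm k (suc (suc n)) (suc n))
        ≡⟨ List.map-++ _ (∑ (suc n) (rhsTerm k (suc (suc n)))) _ ⟩
      X (∑ (suc n) (rhsTerm k (suc (suc n)))) +P X (rhsTerm k (suc (suc n)) (suc n))
        ≡⟨ cong (λ p → X (∑ (suc n) (rhsTerm k (suc (suc n)))) +P X p) (binomScale-last k (suc n) _) ⟩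
      X (∑ (suc n) (rhsTerm k (suc (suc n)))) +P X (N a k (suc (suc n)))
        ∎

  rhs-suc-suc : ∀ k n →
    rhs (suc k) (suc (suc n)) ≋ (tMul (X (rhs k (suc n))) +P Z (rhs k (suc n))) +P X (rhs k (suc (suc n)))
  rhs-suc-suc k n = begin
    rhs (suc k) (suc (suc n))
      ≡⟨ ∑-cong-≡ (suc (suc n)) (λ i → trans (cong (binomScale (suc k) (suc (suc n)) i) (N-suc-suc k i))
                                             (List.map-++ _ (Z (N a k i)) (X (N a k (suc i))))) ⟩
    ∑ (suc (suc n)) (λ i → zTerm i +P xTerm i)         ≈⟨ ∑-distrib (suc (suc n)) zTerm xTerm ⟩
    ∑ (suc (suc n)) zTerm +P ∑ (suc (suc n)) xTerm     ≈⟨ +P-cong (rhs-z-part k n) (rhs-x-part k n) ⟩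
    Z (rhs k (suc n)) +P (tMul (X (rhs k (suc n))) +P X (rhs k (suc (suc n))))
      ≈⟨ x∙yz≈yx∙z (Z (rhs k (suc n))) (tMul (X (rhs k (suc n)))) (X (rhs k (suc (suc n)))) ⟩
    (tMul (X (rhs k (suc n))) +P Z (rhs k (suc n))) +P X (rhs k (suc (suc n))) ∎
    where
    open ≋-Reasoning
    zTerm xTerm : ℕ → Poly
    zTerm i = binomScale (suc k) (suc (suc n)) i (Z (N a k i))
    xTerm i = binomScale (suc k) (suc (suc n)) i (X (N a k (suc i)))

  S-N≋rhs : ∀ n k → S (N a k (suc n)) ≋ rhs k (suc n)
  S-N≋rhs zero    k       = ≋-reflexive (trans (S-ZWords _ (N-zWords k)) (sym (trans (List.++-identityʳ _) (scale-identity _))))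
  S-N≋rhs (suc n) zero    = ≋-reflexive (sym (∑-0P (suc (suc n))))
  S-N≋rhs (suc n) (suc k) = begin
    S (N a (suc k) (suc (suc n)))
      ≈⟨ S-N-suc-suc k n ⟩
    (tMul (X (S (N a k (suc n)))) +P Z (S (N a k (suc n)))) +P X (S (N a k (suc (suc n))))
      ≈⟨ +P-cong (+P-cong (scale-cong 1ℚ 1 (lmul-cong (xPow a) IH)) (lmul-cong (zWord a-1) IH)) (lmul-cong (xPow a) (S-N≋rhs (suc n) k)) ⟩
    (tMul (X (rhs k (suc n))) +P Z (rhs k (suc n))) +P X (rhs k (suc (suc n)))
      ≈⟨ rhs-suc-suc k n ⟨
    rhs (suc k) (suc (suc n)) ∎
    where
    open ≋-Reasoning
    IH : S (N a k (suc n)) ≋ rhs k (suc n)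
    IH = S-N≋rhs n k

RHS≋rhs : ∀ a-1 k n → n ≤ k → RHS (suc a-1) k n ≋ rhs a-1 k n
RHS≋rhs a-1 k n n≤k = begin
  RHS (suc a-1) k n                                            ≡⟨ sumP-map-upTo _ n ⟩
  ∑ n (λ i → scale ⌜ (k ∸ suc i) C (k ∸ n) ⌝ (n ∸ suc i) (N (suc a-1) k (suc i)))
    ≈⟨ ∑-cong n (λ i i<n → ≋-reflexive (cong (λ c → scale ⌜ c ⌝ (n ∸ suc i) (N (suc a-1) k (suc i))) (C-complement (suc i) n k i<n n≤k))) ⟩
  rhs a-1 k n                                                  ∎
  where open ≋-Reasoning

mainTheorem9 : (a k n : ℕ) → 1 ≤ a → 1 ≤ n → n ≤ k →
    S (N a k n) ≈ RHS a k n
mainTheorem9 (suc a-1) k (suc n) _ _ 1+n≤k = ≋⇒≈ (begin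
  S (N (suc a-1) k (suc n))   ≈⟨ S-N≋rhs a-1 n k ⟩
  rhs a-1 k (suc n)           ≈⟨ RHS≋rhs a-1 k (suc n) 1+n≤k ⟨
  RHS (suc a-1) k (suc n)     ∎)
  where open ≋-Reasoning
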